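{- Let $\lambda$ be a nonzero real number. For every positive integer $n$, \[ \sum_{m=1}^{n}B_{m,\lambda}\,S_{1,\lambda}(n,m)=(1)_{n,\lambda}. \]
   Context: For a nonzero real $\lambda$, set $(x)_{0,\lambda}=1$ and $(x)_{n,\lambda}=x(x-\lambda)\cdots(x-(n-1)\lambda)$ for $n\ge1$. Let $e_\lambda^x(t)=\sum_{n\ge0}(x)_{n,\lambda}\frac{t^n}{n!}=(1+\lambda t)^{x/\lambda}$, $e_\lambda(t)=e_\lambda^1(t)$, and $\log_\lambda(1+t)=\frac{1}{\lambda}((1+t)^\lambda-1)$ (the compositional inverse of $e_\lambda$). The degenerate Stirling numbers of the first kind are defined by $\frac{1}{k!}(\log_\lambda(1+t))^k=\sum_{n\ge k}S_{1,\lambda}(n,k)\frac{t^n}{n!}$. The degenerate Bell polynomials are defined by $e_\lambda^x(e_\lambda(t)-1)=\sum_{n\ge0}B_{n,\lambda}(x)\frac{t^n}{n!}$, and the degenerate Bell numbers are $B_{n,\lambda}=B_{n,\lambda}(1)$.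
   Formalization: The parameter λ ranges over the nonzero rationals instead of the nonzero reals. -}

module Defs where

-- Formal power series over ℚ are represented by their ordinary coefficient
-- sequences  ℕ → ℚ  (f n = coefficient of t^n).

open import Data.Nat as ℕ using (ℕ; zero; suc; _∸_; _!)
open import Data.Nat.Properties using (_!≢0)
open import Data.Integer using (+_)
open import Data.Rational using (ℚ; 0ℚ; 1ℚ; _+_; _*_; _-_; _/_; _÷_; NonZero)

ℕtoℚ : ℕ → ℚ
ℕtoℚ n = + n / 1

invFact : ℕ → ℚ
invFact n = (+ 1 / (n !)) {{n !≢0}}

sumTo : ℕ → (ℕ → ℚ) → ℚ
sumTo zero    f = f 0
sumTo (suc n) f = sumTo n f + f (suc n)

sumFrom1 : ℕ → (ℕ → ℚ) → ℚ
sumFrom1 zero    f = 0ℚ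
sumFrom1 (suc n) f = sumFrom1 n f + f (suc n)

fallλ : ℚ → ℚ → ℕ → ℚ
fallλ x lam zero    = 1ℚ
fallλ x lam (suc n) = fallλ x lam n * (x - ℕtoℚ n * lam)

Series : Set
Series = ℕ → ℚ

_⊙_ : Series → Series → Series
(f ⊙ g) n = sumTo n (λ i → f i * g (n ∸ i))

oneS : Series
oneS zero    = 1ℚ
oneS (suc n) = 0ℚ

powS : Series → ℕ → Series
powS f zero    = oneS
powS f (suc k) = f ⊙ powS f k

egf : (ℕ → ℚ) → Series
egf a n = a n * invFact n

eλ^ : ℚ → ℚ → Series
eλ^ lam x = egf (fallλ x lam)

eλ-1 : ℚ → Series
eλ-1 lam zero    = 0ℚ
eλ-1 lam (suc n) = eλ^ lam 1ℚ (suc n)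

-- (1+t)^a  for a ∈ ℚ : the binomial series  Σ (a)_n t^n / n!
binomS : ℚ → Series
binomS a = egf (fallλ a 1ℚ)

-- log_lam(1+t) = ((1+t)^lam - 1) / lam
logλ : (lam : ℚ) → .{{NonZero lam}} → Series
logλ lam zero    = 0ℚ
logλ lam (suc n) = binomS lam (suc n) ÷ lam

S1λ : (lam : ℚ) → .{{NonZero lam}} → ℕ → ℕ → ℚ
S1λ lam n k = ℕtoℚ (n !) * (invFact k * powS (logλ lam) k n)

-- B_{n,lam}(x) = n! [t^n] e_lam^x(e_lam(t) - 1)
--              = n! [t^n] Σ_{k≥0} (x)_{k,lam} (e_lam(t) - 1)^k / k!
-- Since e_lam(t) - 1 has zero constant term, only k ≤ n contribute to [t^n].
Bellλ : ℚ → ℕ → ℚ → ℚ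
Bellλ lam n x = ℕtoℚ (n !) * sumTo n (λ k → eλ^ lam x k * powS (eλ-1 lam) k n)

Bellλ1 : ℚ → ℕ → ℚ
Bellλ1 lam n = Bellλ lam n 1ℚ

module Submission where

-- Write E = e_λ(t) − 1 and L = log_λ(1 + t). Unfolding the definitions,
-- Σ_m B_{m,λ}(x) S_{1,λ}(n,m) = n! Σ_k ((x)_{k,λ} / k!) Σ_m [t^m] E^k · [t^n] L^m,
-- and the inner sum is [t^n] E(L(t))^k = δ_{kn} because L is the compositional inverse of E.
-- This gives (x)_{n,λ} for every x; for n ≥ 1 the term m = 0 vanishes.
-- Composition of series is never formed: E and L satisfy (1 + λt) E′ = 1 + E and
-- (1 + t) L′ = 1 + λ L, and these turn the inner sums into a recurrence in n that δ also satisfies.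

open import Defs
open import Data.Nat as ℕ using (ℕ; zero; suc; _∸_; _!; _≤_; _<_; z≤n; s≤s)
import Data.Nat.Properties as ℕ
import Data.Integer as ℤ
import Data.Integer.Properties as ℤ
open import Data.Rational using (ℚ; 0ℚ; 1ℚ; _+_; _*_; _-_; _/_; 1/_; NonZero; fromℚᵘ)
open import Data.Rational.Properties
import Data.Rational.Unnormalised as ℚᵘ
import Data.Rational.Unnormalised.Properties as ℚᵘ
open import Algebra.Bundles using (CommutativeMonoid)
open import Algebra.Properties.Group +-0-group using () renaming (∙-cancelʳ to +-cancelʳ)
open import Algebra.Properties.CommutativeSemigroup (CommutativeMonoid.commutativeSemigroup *-1-commutativeMonoid)
  using () renaming (x∙yz≈y∙xz to x*yz≡y*xz)
open import Algebra.Properties.CommutativeSemigroup (CommutativeMonoid.commutativeSemigroup +-0-commutativeMonoid)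
  using () renaming (interchange to +-interchange)
open import Data.List using (_∷_; [])
open import Function using (_∘_)
open import Level using (0ℓ)
open import Relation.Nullary.Decidable using (dec⇒maybe)
open import Relation.Binary.PropositionalEquality
import Tactic.RingSolver.Core.AlmostCommutativeRing as ACR
open import Tactic.RingSolver using (solve-∀; solve)

ℚ-ring : ACR.AlmostCommutativeRing 0ℓ 0ℓ
ℚ-ring = ACR.fromCommutativeRing +-*-commutativeRing (λ x → dec⇒maybe (0ℚ ≟ x))

x≡0⇒x*y≡0 : ∀ {x} y → x ≡ 0ℚ → x * y ≡ 0ℚ
x≡0⇒x*y≡0 y refl = *-zeroˡ y

x≡0⇒y*x≡0 : ∀ {x} y → x ≡ 0ℚ → y * x ≡ 0ℚ
x≡0⇒y*x≡0 y refl = *-zeroʳ y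

p*q≡1⇒p*[q*y]≡y : ∀ p q → p * q ≡ 1ℚ → ∀ y → p * (q * y) ≡ y
p*q≡1⇒p*[q*y]≡y p q pq≡1 y = trans (sym (*-assoc p q y)) (trans (cong (_* y) pq≡1) (*-identityˡ y))

fromℚᵘ-homo-+ : ∀ p q → fromℚᵘ (p ℚᵘ.+ q) ≡ fromℚᵘ p + fromℚᵘ q
fromℚᵘ-homo-+ p q = toℚᵘ-injective (ℚᵘ.≃-trans (toℚᵘ-fromℚᵘ (p ℚᵘ.+ q)) (ℚᵘ.≃-sym
  (ℚᵘ.≃-trans (toℚᵘ-homo-+ (fromℚᵘ p) (fromℚᵘ q)) (ℚᵘ.+-cong (toℚᵘ-fromℚᵘ p) (toℚᵘ-fromℚᵘ q)))))

fromℚᵘ-homo-* : ∀ p q → fromℚᵘ (p ℚᵘ.* q) ≡ fromℚᵘ p * fromℚᵘ q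
fromℚᵘ-homo-* p q = toℚᵘ-injective (ℚᵘ.≃-trans (toℚᵘ-fromℚᵘ (p ℚᵘ.* q)) (ℚᵘ.≃-sym
  (ℚᵘ.≃-trans (toℚᵘ-homo-* (fromℚᵘ p) (fromℚᵘ q)) (ℚᵘ.*-cong (toℚᵘ-fromℚᵘ p) (toℚᵘ-fromℚᵘ q)))))

-- ℕtoℚ n reduces to fromℚᵘ (ℕtoℚᵘ n), so ℕtoℚ inherits the homomorphism properties of fromℚᵘ.
ℕtoℚᵘ : ℕ → ℚᵘ.ℚᵘ
ℕtoℚᵘ n = ℚᵘ.mkℚᵘ (ℤ.+ n) 0

ℕtoℚ-+ : ∀ m n → ℕtoℚ (m ℕ.+ n) ≡ ℕtoℚ m + ℕtoℚ n
ℕtoℚ-+ m n = trans (cong fromℚᵘ ℕtoℚᵘ-+) (fromℚᵘ-homo-+ (ℕtoℚᵘ m) (ℕtoℚᵘ n))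
  where
  ℕtoℚᵘ-+ : ℕtoℚᵘ (m ℕ.+ n) ≡ ℕtoℚᵘ m ℚᵘ.+ ℕtoℚᵘ n
  ℕtoℚᵘ-+ = cong (λ i → ℚᵘ.mkℚᵘ i 0)
    (trans (ℤ.pos-+ m n) (sym (cong₂ ℤ._+_ (ℤ.*-identityʳ (ℤ.+ m)) (ℤ.*-identityʳ (ℤ.+ n)))))

ℕtoℚ-* : ∀ m n → ℕtoℚ (m ℕ.* n) ≡ ℕtoℚ m * ℕtoℚ n
ℕtoℚ-* m n = trans (cong (λ i → fromℚᵘ (ℚᵘ.mkℚᵘ i 0)) (ℤ.pos-* m n)) (fromℚᵘ-homo-* (ℕtoℚᵘ m) (ℕtoℚᵘ n))

ℕtoℚ-suc-* : ∀ k x → ℕtoℚ (suc k) * x ≡ x + ℕtoℚ k * x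
ℕtoℚ-suc-* k x = trans (cong (_* x) (ℕtoℚ-+ 1 k))
  (trans (*-distribʳ-+ x 1ℚ (ℕtoℚ k)) (cong (_+ ℕtoℚ k * x) (*-identityˡ x)))

ℕtoℚ-*-inverse : ∀ d .{{_ : ℕ.NonZero d}} → ℕtoℚ d * (ℤ.+ 1 / d) ≡ 1ℚ
ℕtoℚ-*-inverse (suc k) =
  trans (sym (fromℚᵘ-homo-* (ℕtoℚᵘ (suc k)) (ℚᵘ.mkℚᵘ (ℤ.+ 1) k))) (fromℚᵘ-cong (ℚᵘ.*-inverseʳ (ℕtoℚᵘ (suc k))))

ℕtoℚ-suc-*-cancelˡ : ∀ n {x y} → ℕtoℚ (suc n) * x ≡ ℕtoℚ (suc n) * y → x ≡ y
ℕtoℚ-suc-*-cancelˡ n {x} {y} eq = begin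
  x                  ≡⟨ p*q≡1⇒p*[q*y]≡y r N rN≡1 x ⟨
  r * (N * x)        ≡⟨ cong (r *_) eq ⟩
  r * (N * y)        ≡⟨ p*q≡1⇒p*[q*y]≡y r N rN≡1 y ⟩
  y                  ∎
  where
  open ≡-Reasoning
  N = ℕtoℚ (suc n)
  r = ℤ.+ 1 / suc n
  rN≡1 : r * N ≡ 1ℚ
  rN≡1 = trans (*-comm r N) (ℕtoℚ-*-inverse (suc n))

!-*-invFact : ∀ m → ℕtoℚ (m !) * invFact m ≡ 1ℚ
!-*-invFact m = ℕtoℚ-*-inverse (m !) {{m ℕ.!≢0}}

suc-*-invFact-suc : ∀ m → ℕtoℚ (suc m) * invFact (suc m) ≡ invFact m
suc-*-invFact-suc m = from-inverses (ℕtoℚ (suc m)) (invFact (suc m)) (ℕtoℚ (m !)) (invFact m) (!-*-invFact m)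
  (trans (cong (_* invFact (suc m)) (sym (ℕtoℚ-* (suc m) (m !)))) (!-*-invFact (suc m)))
  where
  from-inverses : ∀ M I₁ F I → F * I ≡ 1ℚ → M * F * I₁ ≡ 1ℚ → M * I₁ ≡ I
  from-inverses M I₁ F I FI≡1 MFI₁≡1 = begin
    M * I₁            ≡⟨ *-identityʳ (M * I₁) ⟨
    M * I₁ * 1ℚ       ≡⟨ cong (M * I₁ *_) FI≡1 ⟨
    M * I₁ * (F * I)  ≡⟨ solve (M ∷ I₁ ∷ F ∷ I ∷ []) ℚ-ring ⟩
    M * F * I₁ * I    ≡⟨ cong (_* I) MFI₁≡1 ⟩
    1ℚ * I            ≡⟨ *-identityˡ I ⟩
    I                 ∎
    where open ≡-Reasoning

sumTo-cong : ∀ n {f g : ℕ → ℚ} → (∀ i → i ≤ n → f i ≡ g i) → sumTo n f ≡ sumTo n g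
sumTo-cong zero    f≡g = f≡g 0 z≤n
sumTo-cong (suc n) f≡g =
  cong₂ _+_ (sumTo-cong n (λ i i≤n → f≡g i (ℕ.m≤n⇒m≤1+n i≤n))) (f≡g (suc n) ℕ.≤-refl)

sumTo-zero : ∀ n {f : ℕ → ℚ} → (∀ i → i ≤ n → f i ≡ 0ℚ) → sumTo n f ≡ 0ℚ
sumTo-zero zero    f≡0 = f≡0 0 z≤n
sumTo-zero (suc n) f≡0 = trans
  (cong₂ _+_ (sumTo-zero n (λ i i≤n → f≡0 i (ℕ.m≤n⇒m≤1+n i≤n))) (f≡0 (suc n) ℕ.≤-refl))
  (+-identityʳ 0ℚ)

sumTo-+ : ∀ n (f g : ℕ → ℚ) → sumTo n (λ i → f i + g i) ≡ sumTo n f + sumTo n g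
sumTo-+ zero    f g = refl
sumTo-+ (suc n) f g = trans (cong (_+ (f (suc n) + g (suc n))) (sumTo-+ n f g))
  (+-interchange (sumTo n f) (sumTo n g) (f (suc n)) (g (suc n)))

sumTo-*ˡ : ∀ n c (f : ℕ → ℚ) → sumTo n (λ i → c * f i) ≡ c * sumTo n f
sumTo-*ˡ zero    c f = refl
sumTo-*ˡ (suc n) c f = trans (cong (_+ c * f (suc n)) (sumTo-*ˡ n c f))
  (sym (*-distribˡ-+ c (sumTo n f) (f (suc n))))

sumTo-*ʳ : ∀ n c (f : ℕ → ℚ) → sumTo n (λ i → f i * c) ≡ sumTo n f * c
sumTo-*ʳ zero    c f = refl
sumTo-*ʳ (suc n) c f = trans (cong (_+ f (suc n) * c) (sumTo-*ʳ n c f))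
  (sym (*-distribʳ-+ c (sumTo n f) (f (suc n))))

sumTo-+-* : ∀ n c (f g : ℕ → ℚ) → sumTo n (λ i → f i + c * g i) ≡ sumTo n f + c * sumTo n g
sumTo-+-* n c f g = trans (sumTo-+ n f (λ i → c * g i)) (cong (sumTo n f +_) (sumTo-*ˡ n c g))

sumTo-suc : ∀ n (f : ℕ → ℚ) → sumTo (suc n) f ≡ f 0 + sumTo n (f ∘ suc)
sumTo-suc zero    f = refl
sumTo-suc (suc n) f = trans (cong (_+ f (suc (suc n))) (sumTo-suc n f)) (+-assoc (f 0) _ _)

sumTo-drop-first : ∀ n (f : ℕ → ℚ) → f 0 ≡ 0ℚ → sumTo (suc n) f ≡ sumTo n (f ∘ suc)
sumTo-drop-first n f f₀ =
  trans (sumTo-suc n f) (trans (cong (_+ sumTo n (f ∘ suc)) f₀) (+-identityˡ (sumTo n (f ∘ suc))))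

sumTo-drop-last : ∀ n (f : ℕ → ℚ) → f (suc n) ≡ 0ℚ → sumTo (suc n) f ≡ sumTo n f
sumTo-drop-last n f f₊ = trans (cong (sumTo n f +_) f₊) (+-identityʳ (sumTo n f))

sumTo-comm : ∀ m n (f : ℕ → ℕ → ℚ) →
  sumTo m (λ i → sumTo n (f i)) ≡ sumTo n (λ j → sumTo m (λ i → f i j))
sumTo-comm zero    n f = refl
sumTo-comm (suc m) n f = trans (cong (_+ sumTo n (f (suc m))) (sumTo-comm m n f))
  (sym (sumTo-+ n (λ j → sumTo m (λ i → f i j)) (f (suc m))))

sumTo-extend : ∀ {m n} (f : ℕ → ℚ) → m ≤ n → (∀ j → m < j → f j ≡ 0ℚ) → sumTo n f ≡ sumTo m f
sumTo-extend {m} f m≤n f≡0 = go (ℕ.≤⇒≤′ m≤n)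
  where
  go : ∀ {n} → m ℕ.≤′ n → sumTo n f ≡ sumTo m f
  go ℕ.≤′-refl        = refl
  go (ℕ.≤′-step m≤′n) =
    trans (cong₂ _+_ (go m≤′n) (f≡0 _ (s≤s (ℕ.≤′⇒≤ m≤′n)))) (+-identityʳ (sumTo m f))

sumTo≡sumFrom1 : ∀ n (f : ℕ → ℚ) → f 0 ≡ 0ℚ → sumTo n f ≡ sumFrom1 n f
sumTo≡sumFrom1 zero    f f0≡0 = f0≡0
sumTo≡sumFrom1 (suc n) f f0≡0 = cong (_+ f (suc n)) (sumTo≡sumFrom1 n f f0≡0)

δ : ℕ → ℕ → ℚ
δ zero    zero    = 1ℚ
δ zero    (suc n) = 0ℚ
δ (suc k) zero    = 0ℚ
δ (suc k) (suc n) = δ k n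

δ-diagonal : ∀ (f : ℕ → ℚ) k n → f k * δ k n ≡ f n * δ k n
δ-diagonal f zero    zero    = refl
δ-diagonal f zero    (suc n) = trans (*-zeroʳ (f 0)) (sym (*-zeroʳ (f (suc n))))
δ-diagonal f (suc k) zero    = trans (*-zeroʳ (f (suc k))) (sym (*-zeroʳ (f 0)))
δ-diagonal f (suc k) (suc n) = δ-diagonal (f ∘ suc) k n

sumTo-δ : ∀ n → sumTo n (λ k → δ k n) ≡ 1ℚ
sumTo-δ zero    = refl
sumTo-δ (suc n) = trans (sumTo-suc n (λ k → δ k (suc n))) (trans (+-identityˡ _) (sumTo-δ n))

sumTo-*-δ : ∀ n (f : ℕ → ℚ) → sumTo n (λ k → f k * δ k n) ≡ f n
sumTo-*-δ n f = begin
  sumTo n (λ k → f k * δ k n)  ≡⟨ sumTo-cong n (λ k _ → δ-diagonal f k n) ⟩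
  sumTo n (λ k → f n * δ k n)  ≡⟨ sumTo-*ˡ n (f n) (λ k → δ k n) ⟩
  f n * sumTo n (λ k → δ k n)  ≡⟨ cong (f n *_) (sumTo-δ n) ⟩
  f n * 1ℚ                     ≡⟨ *-identityʳ (f n) ⟩
  f n                          ∎
  where open ≡-Reasoning

infixl 6 _⊕_
infixr 7 _·_

_⊕_ : Series → Series → Series
(f ⊕ g) n = f n + g n

_·_ : ℚ → Series → Series
(c · f) n = c * f n

⊙-congˡ : ∀ {f f′ : Series} → f ≗ f′ → ∀ g → f ⊙ g ≗ f′ ⊙ g
⊙-congˡ f≗f′ g n = sumTo-cong n (λ i _ → cong (_* g (n ∸ i)) (f≗f′ i))

⊙-congʳ : ∀ f {g g′ : Series} → g ≗ g′ → f ⊙ g ≗ f ⊙ g′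
⊙-congʳ f g≗g′ n = sumTo-cong n (λ i _ → cong (f i *_) (g≗g′ (n ∸ i)))

⊙-distribʳ-⊕ : ∀ (f g h : Series) → (f ⊕ g) ⊙ h ≗ (f ⊙ h) ⊕ (g ⊙ h)
⊙-distribʳ-⊕ f g h n =
  trans (sumTo-cong n (λ i _ → *-distribʳ-+ (h (n ∸ i)) (f i) (g i))) (sumTo-+ n _ _)

⊙-distribˡ-⊕ : ∀ (f g h : Series) → f ⊙ (g ⊕ h) ≗ (f ⊙ g) ⊕ (f ⊙ h)
⊙-distribˡ-⊕ f g h n =
  trans (sumTo-cong n (λ i _ → *-distribˡ-+ (f i) (g (n ∸ i)) (h (n ∸ i)))) (sumTo-+ n _ _)

·-⊙ : ∀ c (f g : Series) → (c · f) ⊙ g ≗ c · (f ⊙ g)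
·-⊙ c f g n = trans (sumTo-cong n (λ i _ → *-assoc c (f i) (g (n ∸ i)))) (sumTo-*ˡ n c _)

⊙-· : ∀ c (f g : Series) → f ⊙ (c · g) ≗ c · (f ⊙ g)
⊙-· c f g n = trans (sumTo-cong n (λ i _ → x*yz≡y*xz (f i) c (g (n ∸ i)))) (sumTo-*ˡ n c _)

oneS-⊙ : ∀ (g : Series) → oneS ⊙ g ≗ g
oneS-⊙ g zero    = *-identityˡ (g 0)
oneS-⊙ g (suc n) = begin
  (oneS ⊙ g) (suc n)
    ≡⟨ sumTo-suc n (λ i → oneS i * g (suc n ∸ i)) ⟩
  1ℚ * g (suc n) + sumTo n (λ i → 0ℚ * g (n ∸ i))
    ≡⟨ cong₂ _+_ (*-identityˡ (g (suc n))) (sumTo-zero n (λ i _ → *-zeroˡ (g (n ∸ i)))) ⟩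
  g (suc n) + 0ℚ
    ≡⟨ +-identityʳ (g (suc n)) ⟩
  g (suc n) ∎
  where open ≡-Reasoning

powS-vanish : ∀ (F : Series) → F 0 ≡ 0ℚ → ∀ k n → n < k → powS F k n ≡ 0ℚ
powS-vanish F F₀ (suc k) n n<1+k = sumTo-zero n (term n<1+k)
  where
  term : ∀ {n} → n < suc k → ∀ i → i ≤ n → F i * powS F k (n ∸ i) ≡ 0ℚ
  term {n} _ zero _ = x≡0⇒x*y≡0 (powS F k n) F₀
  term {suc n} (s≤s n<k) (suc i) _ =
    x≡0⇒y*x≡0 (F (suc i)) (powS-vanish F F₀ k (n ∸ i) (ℕ.≤-<-trans (ℕ.m∸n≤m n i) n<k))

-- θ = t d/dt and D a = (1 + a t) d/dt, acting on coefficient sequences.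
θ : Series → Series
θ f n = ℕtoℚ n * f n

D : ℚ → Series → Series
D a f = (θ f ∘ suc) ⊕ (a · θ f)

θ-zero : ∀ (f : Series) → θ f 0 ≡ 0ℚ
θ-zero f = *-zeroˡ (f 0)

θ-oneS : ∀ n → θ oneS n ≡ 0ℚ
θ-oneS zero    = refl
θ-oneS (suc n) = *-zeroʳ (ℕtoℚ (suc n))

θ-⊙ : ∀ (f g : Series) → θ (f ⊙ g) ≗ (θ f ⊙ g) ⊕ (f ⊙ θ g)
θ-⊙ f g n = trans (sym (sumTo-*ˡ n (ℕtoℚ n) _))
  (trans (sumTo-cong n (λ i i≤n → term (ℕtoℚ n) (ℕtoℚ i) (ℕtoℚ (n ∸ i)) (f i) (g (n ∸ i)) (split i≤n)))
         (sumTo-+ n _ _))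
  where
  split : ∀ {i} → i ≤ n → ℕtoℚ n ≡ ℕtoℚ i + ℕtoℚ (n ∸ i)
  split {i} i≤n = trans (cong ℕtoℚ (sym (ℕ.m+[n∸m]≡n i≤n))) (ℕtoℚ-+ i (n ∸ i))
  term : ∀ N I J x y → N ≡ I + J → N * (x * y) ≡ (I * x) * y + x * (J * y)
  term _ I J x y refl = solve (I ∷ J ∷ x ∷ y ∷ []) ℚ-ring

⊙-shiftˡ : ∀ (h g : Series) → h 0 ≡ 0ℚ → ∀ m → (h ⊙ g) (suc m) ≡ ((h ∘ suc) ⊙ g) m
⊙-shiftˡ h g h₀ m = sumTo-drop-first m (λ i → h i * g (suc m ∸ i)) (x≡0⇒x*y≡0 (g (suc m)) h₀)

⊙-shiftʳ : ∀ (f h : Series) → h 0 ≡ 0ℚ → ∀ m → (f ⊙ h) (suc m) ≡ (f ⊙ (h ∘ suc)) m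
⊙-shiftʳ f h h₀ m = begin
  (f ⊙ h) (suc m)
    ≡⟨ sumTo-drop-last m (λ i → f i * h (suc m ∸ i)) (x≡0⇒y*x≡0 (f (suc m)) (trans (cong h (ℕ.n∸n≡0 m)) h₀)) ⟩
  sumTo m (λ i → f i * h (suc m ∸ i))
    ≡⟨ sumTo-cong m (λ i i≤m → cong (λ j → f i * h j) (ℕ.+-∸-assoc 1 i≤m)) ⟩
  (f ⊙ (h ∘ suc)) m
    ∎
  where open ≡-Reasoning

D-⊙ : ∀ a (f g : Series) → D a (f ⊙ g) ≗ (D a f ⊙ g) ⊕ (f ⊙ D a g)
D-⊙ a f g m = begin
  θ (f ⊙ g) (suc m) + a * θ (f ⊙ g) m
    ≡⟨ cong₂ (λ u v → u + a * v) (θ-⊙ f g (suc m)) (θ-⊙ f g m) ⟩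
  ((θ f ⊙ g) (suc m) + (f ⊙ θ g) (suc m)) + a * (r + s)
    ≡⟨ cong₂ (λ u v → (u + v) + a * (r + s)) (⊙-shiftˡ (θ f) g (θ-zero f) m) (⊙-shiftʳ f (θ g) (θ-zero g) m) ⟩
  (p + q) + a * (r + s)
    ≡⟨ regroup a p q r s ⟩
  (p + a * r) + (q + a * s)
    ≡⟨ cong₂ (λ u v → (p + u) + (q + v)) (·-⊙ a (θ f) g m) (⊙-· a f (θ g) m) ⟨
  (p + ((a · θ f) ⊙ g) m) + (q + (f ⊙ (a · θ g)) m)
    ≡⟨ cong₂ _+_ (⊙-distribʳ-⊕ (θ f ∘ suc) (a · θ f) g m) (⊙-distribˡ-⊕ f (θ g ∘ suc) (a · θ g) m) ⟨
  (D a f ⊙ g) m + (f ⊙ D a g) m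
    ∎
  where
  open ≡-Reasoning
  p = ((θ f ∘ suc) ⊙ g) m
  q = (f ⊙ (θ g ∘ suc)) m
  r = (θ f ⊙ g) m
  s = (f ⊙ θ g) m
  regroup : ∀ a p q r s → (p + q) + a * (r + s) ≡ (p + a * r) + (q + a * s)
  regroup = solve-∀ ℚ-ring

D-· : ∀ a c (f : Series) → D a (c · f) ≗ c · D a f
D-· a c f m = pull-out a c (ℕtoℚ (suc m)) (f (suc m)) (ℕtoℚ m) (f m)
  where
  pull-out : ∀ a c p x q y → p * (c * x) + a * (q * (c * y)) ≡ c * (p * x + a * (q * y))
  pull-out = solve-∀ ℚ-ring

D-cong-suc : ∀ a (f g : Series) → (∀ m → f (suc m) ≡ g (suc m)) → D a f ≗ D a g
D-cong-suc a f g eq zero    =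
  cong₂ (λ u v → ℕtoℚ 1 * u + a * v) (eq 0) (trans (θ-zero f) (sym (θ-zero g)))
D-cong-suc a f g eq (suc m) =
  cong₂ (λ u v → ℕtoℚ (suc (suc m)) * u + a * (ℕtoℚ (suc m) * v)) (eq (suc m)) (eq m)

D-oneS : ∀ a m → D a oneS m ≡ 0ℚ
D-oneS a m = trans (cong₂ (λ u v → u + a * v) (θ-oneS (suc m)) (θ-oneS m))
                   (trans (+-identityˡ (a * 0ℚ)) (*-zeroʳ a))

D-powS : ∀ a b (F : Series) → D a F ≗ oneS ⊕ b · F →
         ∀ k → D a (powS F k) ≗ ℕtoℚ k · (powS F (k ∸ 1) ⊕ b · powS F k)
D-powS a b F F-ode zero    m = trans (D-oneS a m) (sym (*-zeroˡ (oneS m + b * oneS m)))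
D-powS a b F F-ode (suc k) m = begin
  D a (F ⊙ P) m
    ≡⟨ D-⊙ a F P m ⟩
  (D a F ⊙ P) m + (F ⊙ D a P) m
    ≡⟨ cong₂ _+_ (⊙-congˡ F-ode P m) (⊙-congʳ F (D-powS a b F F-ode k) m) ⟩
  ((oneS ⊕ b · F) ⊙ P) m + (F ⊙ (ℕtoℚ k · (P′ ⊕ b · P))) m
    ≡⟨ cong₂ _+_ left right ⟩
  (P m + b * P₁ m) + ℕtoℚ k * ((F ⊙ P′) m + b * P₁ m)
    ≡⟨ cong ((P m + b * P₁ m) +_) (lower k) ⟩
  (P m + b * P₁ m) + ℕtoℚ k * (P m + b * P₁ m)
    ≡⟨ ℕtoℚ-suc-* k (P m + b * P₁ m) ⟨
  ℕtoℚ (suc k) * (P m + b * P₁ m)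
    ∎
  where
  open ≡-Reasoning
  P = powS F k
  P′ = powS F (k ∸ 1)
  P₁ = powS F (suc k)
  left : ((oneS ⊕ b · F) ⊙ P) m ≡ P m + b * P₁ m
  left = trans (⊙-distribʳ-⊕ oneS (b · F) P m) (cong₂ _+_ (oneS-⊙ P m) (·-⊙ b F P m))
  right : (F ⊙ (ℕtoℚ k · (P′ ⊕ b · P))) m ≡ ℕtoℚ k * ((F ⊙ P′) m + b * P₁ m)
  right = trans (⊙-· (ℕtoℚ k) F (P′ ⊕ b · P) m)
    (cong (ℕtoℚ k *_) (trans (⊙-distribˡ-⊕ F P′ (b · P) m) (cong ((F ⊙ P′) m +_) (⊙-· b F P m))))
  lower : ∀ j → ℕtoℚ j * ((F ⊙ powS F (j ∸ 1)) m + b * P₁ m) ≡ ℕtoℚ j * (powS F j m + b * P₁ m)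
  lower zero    = trans (*-zeroˡ ((F ⊙ oneS) m + b * P₁ m)) (sym (*-zeroˡ (oneS m + b * P₁ m)))
  lower (suc j) = refl

D-eλ^ : ∀ lam x → D lam (eλ^ lam x) ≗ x · eλ^ lam x
D-eλ^ lam x m = coefficient (ℕtoℚ (suc m)) (invFact (suc m)) (ℕtoℚ m) (invFact m) (fallλ x lam m)
  (suc-*-invFact-suc m)
  where
  coefficient : ∀ M₁ I₁ M I F → M₁ * I₁ ≡ I →
                M₁ * (F * (x - M * lam) * I₁) + lam * (M * (F * I)) ≡ x * (F * I)
  coefficient M₁ I₁ M I F M₁I₁≡I = begin
    M₁ * (F * (x - M * lam) * I₁) + lam * (M * (F * I))
      ≡⟨ solve (M₁ ∷ I₁ ∷ M ∷ I ∷ F ∷ x ∷ lam ∷ []) ℚ-ring ⟩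
    F * (x - M * lam) * (M₁ * I₁) + lam * (M * (F * I))
      ≡⟨ cong (λ z → F * (x - M * lam) * z + lam * (M * (F * I))) M₁I₁≡I ⟩
    F * (x - M * lam) * I + lam * (M * (F * I))
      ≡⟨ solve (M ∷ I ∷ F ∷ x ∷ lam ∷ []) ℚ-ring ⟩
    x * (F * I)
      ∎
    where open ≡-Reasoning

-- e_λ(t) − 1 and e_λ(t) differ only in the constant term, which D does not see.
eλ-1-ode : ∀ lam → D lam (eλ-1 lam) ≗ oneS ⊕ 1ℚ · eλ-1 lam
eλ-1-ode lam m =
  trans (D-cong-suc lam (eλ-1 lam) (eλ^ lam 1ℚ) (λ _ → refl) m) (trans (D-eλ^ lam 1ℚ m) (split m))
  where
  split : ∀ m → 1ℚ * eλ^ lam 1ℚ m ≡ oneS m + 1ℚ * eλ-1 lam m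
  split zero    = refl
  split (suc m) = sym (+-identityˡ (1ℚ * eλ-1 lam (suc m)))

logλ-ode : ∀ lam .{{_ : NonZero lam}} → D 1ℚ (logλ lam) ≗ oneS ⊕ lam · logλ lam
logλ-ode lam m = begin
  D 1ℚ (logλ lam) m
    ≡⟨ D-cong-suc 1ℚ (logλ lam) (1/ lam · binomS lam) (λ n → *-comm (binomS lam (suc n)) (1/ lam)) m ⟩
  D 1ℚ (1/ lam · binomS lam) m
    ≡⟨ D-· 1ℚ (1/ lam) (binomS lam) m ⟩
  1/ lam * D 1ℚ (binomS lam) m
    ≡⟨ cong (1/ lam *_) (D-eλ^ 1ℚ lam m) ⟩
  1/ lam * (lam * binomS lam m)
    ≡⟨ p*q≡1⇒p*[q*y]≡y (1/ lam) lam (*-inverseˡ lam) (binomS lam m) ⟩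
  binomS lam m
    ≡⟨ split m ⟩
  oneS m + lam * logλ lam m
    ∎
  where
  open ≡-Reasoning
  split : ∀ m → binomS lam m ≡ oneS m + lam * logλ lam m
  split zero    = sym (trans (cong (1ℚ +_) (*-zeroʳ lam)) (+-identityʳ 1ℚ))
  split (suc m) = sym (trans (+-identityˡ _) (trans (cong (lam *_) (*-comm (binomS lam (suc m)) (1/ lam)))
                                                    (p*q≡1⇒p*[q*y]≡y lam (1/ lam) (*-inverseʳ lam) (binomS lam (suc m)))))

-- Summation by parts: the shift m ↦ m ∸ 1 on c becomes m ↦ m + 1 on e.
sumTo-D-transpose : ∀ a (e c : ℕ → ℚ) n → c (suc n) ≡ 0ℚ →
  sumTo (suc n) (λ m → e m * (ℕtoℚ m * (c (m ∸ 1) + a * c m))) ≡ sumTo n (λ m → D a e m * c m)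
sumTo-D-transpose a e c n c₊≡0 = begin
  sumTo (suc n) (λ m → e m * (ℕtoℚ m * (c (m ∸ 1) + a * c m)))
    ≡⟨ sumTo-cong (suc n) (λ m _ → expand a (e m) (ℕtoℚ m) (c (m ∸ 1)) (c m)) ⟩
  sumTo (suc n) (λ m → θ e m * c (m ∸ 1) + a * (θ e m * c m))
    ≡⟨ sumTo-+ (suc n) (λ m → θ e m * c (m ∸ 1)) (λ m → a * (θ e m * c m)) ⟩
  sumTo (suc n) (λ m → θ e m * c (m ∸ 1)) + sumTo (suc n) (λ m → a * (θ e m * c m))
    ≡⟨ cong₂ _+_ drop-first drop-last ⟩
  sumTo n (λ m → θ e (suc m) * c m) + sumTo n (λ m → a * (θ e m * c m))
    ≡⟨ sumTo-+ n (λ m → θ e (suc m) * c m) (λ m → a * (θ e m * c m)) ⟨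
  sumTo n (λ m → θ e (suc m) * c m + a * (θ e m * c m))
    ≡⟨ sumTo-cong n (λ m _ → collect a (θ e (suc m)) (θ e m) (c m)) ⟩
  sumTo n (λ m → D a e m * c m)
    ∎
  where
  open ≡-Reasoning
  expand : ∀ a x y p q → x * (y * (p + a * q)) ≡ (y * x) * p + a * ((y * x) * q)
  expand = solve-∀ ℚ-ring
  collect : ∀ a x y p → x * p + a * (y * p) ≡ (x + a * y) * p
  collect = solve-∀ ℚ-ring
  drop-first : sumTo (suc n) (λ m → θ e m * c (m ∸ 1)) ≡ sumTo n (λ m → θ e (suc m) * c m)
  drop-first = sumTo-drop-first n (λ m → θ e m * c (m ∸ 1)) (x≡0⇒x*y≡0 (c 0) (θ-zero e))
  drop-last : sumTo (suc n) (λ m → a * (θ e m * c m)) ≡ sumTo n (λ m → a * (θ e m * c m))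
  drop-last = sumTo-drop-last n (λ m → a * (θ e m * c m)) (x≡0⇒y*x≡0 a (x≡0⇒y*x≡0 (θ e (suc n)) c₊≡0))

δ-recurrence : ∀ b k n →
  ℕtoℚ (suc n) * δ k (suc n) + b * (ℕtoℚ n * δ k n) ≡ ℕtoℚ k * (δ (k ∸ 1) n + b * δ k n)
δ-recurrence b k n = begin
  ℕtoℚ (suc n) * δ k (suc n) + b * (ℕtoℚ n * δ k n)
    ≡⟨ cong₂ (λ u v → u + b * v) (shift k) (sym (δ-diagonal ℕtoℚ k n)) ⟩
  ℕtoℚ k * δ (k ∸ 1) n + b * (ℕtoℚ k * δ k n)
    ≡⟨ factor b (ℕtoℚ k) (δ (k ∸ 1) n) (δ k n) ⟩
  ℕtoℚ k * (δ (k ∸ 1) n + b * δ k n)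
    ∎
  where
  open ≡-Reasoning
  shift : ∀ k → ℕtoℚ (suc n) * δ k (suc n) ≡ ℕtoℚ k * δ (k ∸ 1) n
  shift zero    = trans (*-zeroʳ (ℕtoℚ (suc n))) (sym (*-zeroˡ (δ 0 n)))
  shift (suc j) = sym (δ-diagonal (ℕtoℚ ∘ suc) j n)
  factor : ∀ b p x y → p * x + b * (p * y) ≡ p * (x + b * y)
  factor = solve-∀ ℚ-ring

module Inversion (a b : ℚ) (E L : Series) (E₀ : E 0 ≡ 0ℚ) (L₀ : L 0 ≡ 0ℚ)
                 (E-ode : D a E ≗ oneS ⊕ b · E) (L-ode : D b L ≗ oneS ⊕ a · L) where

  -- The two equations make L the compositional inverse of E, and C k n is the coefficient
  -- of t^n in E(L(t))^k (the terms m > n vanish because L(0) = 0).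
  C : ℕ → ℕ → ℚ
  C k n = sumTo n (λ m → powS E k m * powS L m n)

  C-suc-via-D : ∀ k n → ℕtoℚ (suc n) * C k (suc n) + b * (ℕtoℚ n * C k n) ≡
                         sumTo (suc n) (λ m → powS E k m * D b (powS L m) n)
  C-suc-via-D k n = begin
    N₁ * C k (suc n) + b * (N * C k n)
      ≡⟨ cong (λ z → N₁ * C k (suc n) + b * (N * z)) C-extend ⟩
    N₁ * sumTo (suc n) (λ m → e m * ℓ m (suc n)) + b * (N * sumTo (suc n) (λ m → e m * ℓ m n))
      ≡⟨ cong₂ (λ u v → u + b * v) (sumTo-*ˡ (suc n) N₁ (λ m → e m * ℓ m (suc n)))
                                   (sumTo-*ˡ (suc n) N (λ m → e m * ℓ m n)) ⟨
    sumTo (suc n) (λ m → N₁ * (e m * ℓ m (suc n))) + b * sumTo (suc n) (λ m → N * (e m * ℓ m n))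
      ≡⟨ sumTo-+-* (suc n) b (λ m → N₁ * (e m * ℓ m (suc n))) (λ m → N * (e m * ℓ m n)) ⟨
    sumTo (suc n) (λ m → N₁ * (e m * ℓ m (suc n)) + b * (N * (e m * ℓ m n)))
      ≡⟨ sumTo-cong (suc n) (λ m _ → factor b N₁ N (e m) (ℓ m (suc n)) (ℓ m n)) ⟩
    sumTo (suc n) (λ m → e m * D b (powS L m) n)
      ∎
    where
    open ≡-Reasoning
    N₁ = ℕtoℚ (suc n)
    N = ℕtoℚ n
    e = powS E k
    ℓ = powS L
    C-extend : C k n ≡ sumTo (suc n) (λ m → e m * ℓ m n)
    C-extend = sym (sumTo-drop-last n (λ m → e m * ℓ m n)
                     (x≡0⇒y*x≡0 (e (suc n)) (powS-vanish L L₀ (suc n) n ℕ.≤-refl)))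
    factor : ∀ b p q x y z → p * (x * y) + b * (q * (x * z)) ≡ x * (p * y + b * (q * z))
    factor = solve-∀ ℚ-ring

  C-recurrence : ∀ k n →
    ℕtoℚ (suc n) * C k (suc n) + b * (ℕtoℚ n * C k n) ≡ ℕtoℚ k * (C (k ∸ 1) n + b * C k n)
  C-recurrence k n = begin
    ℕtoℚ (suc n) * C k (suc n) + b * (ℕtoℚ n * C k n)
      ≡⟨ C-suc-via-D k n ⟩
    sumTo (suc n) (λ m → e m * D b (powS L m) n)
      ≡⟨ sumTo-cong (suc n) (λ m _ → cong (e m *_) (D-powS b a L L-ode m n)) ⟩
    sumTo (suc n) (λ m → e m * (ℕtoℚ m * (ℓ (m ∸ 1) + a * ℓ m)))
      ≡⟨ sumTo-D-transpose a e ℓ n (powS-vanish L L₀ (suc n) n ℕ.≤-refl) ⟩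
    sumTo n (λ m → D a e m * ℓ m)
      ≡⟨ sumTo-cong n (λ m _ → trans (cong (_* ℓ m) (D-powS a b E E-ode k m))
                                      (distrib b (ℕtoℚ k) (e′ m) (e m) (ℓ m))) ⟩
    sumTo n (λ m → ℕtoℚ k * (e′ m * ℓ m + b * (e m * ℓ m)))
      ≡⟨ sumTo-*ˡ n (ℕtoℚ k) (λ m → e′ m * ℓ m + b * (e m * ℓ m)) ⟩
    ℕtoℚ k * sumTo n (λ m → e′ m * ℓ m + b * (e m * ℓ m))
      ≡⟨ cong (ℕtoℚ k *_) (sumTo-+-* n b (λ m → e′ m * ℓ m) (λ m → e m * ℓ m)) ⟩
    ℕtoℚ k * (C (k ∸ 1) n + b * C k n)
      ∎
    where
    open ≡-Reasoning
    e = powS E k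
    e′ = powS E (k ∸ 1)
    ℓ : ℕ → ℚ
    ℓ m = powS L m n
    distrib : ∀ b K p q l → K * (p + b * q) * l ≡ K * (p * l + b * (q * l))
    distrib = solve-∀ ℚ-ring

  orthogonal : ∀ n k → C k n ≡ δ k n
  orthogonal zero    zero    = refl
  orthogonal zero    (suc k) = trans (*-identityʳ (powS E (suc k) 0)) (powS-vanish E E₀ (suc k) 0 (s≤s z≤n))
  orthogonal (suc n) k = ℕtoℚ-suc-*-cancelˡ n (+-cancelʳ (b * (ℕtoℚ n * δ k n)) _ _ (begin
    ℕtoℚ (suc n) * C k (suc n) + b * (ℕtoℚ n * δ k n)
      ≡⟨ cong (λ z → ℕtoℚ (suc n) * C k (suc n) + b * (ℕtoℚ n * z)) (orthogonal n k) ⟨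
    ℕtoℚ (suc n) * C k (suc n) + b * (ℕtoℚ n * C k n)
      ≡⟨ C-recurrence k n ⟩
    ℕtoℚ k * (C (k ∸ 1) n + b * C k n)
      ≡⟨ cong₂ (λ u v → ℕtoℚ k * (u + b * v)) (orthogonal n (k ∸ 1)) (orthogonal n k) ⟩
    ℕtoℚ k * (δ (k ∸ 1) n + b * δ k n)
      ≡⟨ δ-recurrence b k n ⟨
    ℕtoℚ (suc n) * δ k (suc n) + b * (ℕtoℚ n * δ k n)
      ∎))
    where open ≡-Reasoning

  inversion : ∀ (w : ℕ → ℚ) n →
    sumTo n (λ m → sumTo m (λ k → w k * powS E k m) * powS L m n) ≡ w n
  inversion w n = begin
    sumTo n (λ m → sumTo m (λ k → w k * powS E k m) * powS L m n)
      ≡⟨ sumTo-cong n (λ m m≤n → cong (_* powS L m n) (extend m≤n)) ⟩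
    sumTo n (λ m → sumTo n (λ k → w k * powS E k m) * powS L m n)
      ≡⟨ sumTo-cong n (λ m _ → sym (sumTo-*ʳ n (powS L m n) (λ k → w k * powS E k m))) ⟩
    sumTo n (λ m → sumTo n (λ k → w k * powS E k m * powS L m n))
      ≡⟨ sumTo-comm n n (λ m k → w k * powS E k m * powS L m n) ⟩
    sumTo n (λ k → sumTo n (λ m → w k * powS E k m * powS L m n))
      ≡⟨ sumTo-cong n (λ k _ → sumTo-cong n (λ m _ → *-assoc (w k) (powS E k m) (powS L m n))) ⟩
    sumTo n (λ k → sumTo n (λ m → w k * (powS E k m * powS L m n)))
      ≡⟨ sumTo-cong n (λ k _ → trans (sumTo-*ˡ n (w k) _) (cong (w k *_) (orthogonal n k))) ⟩
    sumTo n (λ k → w k * δ k n)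
      ≡⟨ sumTo-*-δ n w ⟩
    w n
      ∎
    where
    open ≡-Reasoning
    extend : ∀ {m} → m ≤ n → sumTo m (λ k → w k * powS E k m) ≡ sumTo n (λ k → w k * powS E k m)
    extend {m} m≤n = sym (sumTo-extend (λ k → w k * powS E k m) m≤n
      (λ k m<k → x≡0⇒y*x≡0 (w k) (powS-vanish E E₀ k m m<k)))

!-*-egf : ∀ (a : ℕ → ℚ) n → ℕtoℚ (n !) * egf a n ≡ a n
!-*-egf a n = begin
  ℕtoℚ (n !) * (a n * invFact n)  ≡⟨ x*yz≡y*xz (ℕtoℚ (n !)) (a n) (invFact n) ⟩
  a n * (ℕtoℚ (n !) * invFact n)  ≡⟨ cong (a n *_) (!-*-invFact n) ⟩
  a n * 1ℚ                        ≡⟨ *-identityʳ (a n) ⟩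
  a n                             ∎
  where open ≡-Reasoning

Bellλ-*-S1λ : ∀ lam .{{_ : NonZero lam}} x n m → Bellλ lam m x * S1λ lam n m ≡
  ℕtoℚ (n !) * (sumTo m (λ k → eλ^ lam x k * powS (eλ-1 lam) k m) * powS (logλ lam) m n)
Bellλ-*-S1λ lam x n m = cancel-factorial (ℕtoℚ (m !)) (invFact m) (ℕtoℚ (n !)) _ _ (!-*-invFact m)
  where
  cancel-factorial : ∀ M I N s c → M * I ≡ 1ℚ → (M * s) * (N * (I * c)) ≡ N * (s * c)
  cancel-factorial M I N s c MI≡1 = begin
    (M * s) * (N * (I * c))  ≡⟨ solve (M ∷ I ∷ N ∷ s ∷ c ∷ []) ℚ-ring ⟩
    N * (s * c) * (M * I)    ≡⟨ cong (N * (s * c) *_) MI≡1 ⟩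
    N * (s * c) * 1ℚ         ≡⟨ *-identityʳ (N * (s * c)) ⟩
    N * (s * c)              ∎
    where open ≡-Reasoning

sumTo-Bellλ-*-S1λ : ∀ lam .{{_ : NonZero lam}} x n →
  sumTo n (λ m → Bellλ lam m x * S1λ lam n m) ≡ fallλ x lam n
sumTo-Bellλ-*-S1λ lam x n = begin
  sumTo n (λ m → Bellλ lam m x * S1λ lam n m)
    ≡⟨ sumTo-cong n (λ m _ → Bellλ-*-S1λ lam x n m) ⟩
  sumTo n (λ m → ℕtoℚ (n !) * (sumTo m (λ k → eλ^ lam x k * powS E k m) * powS L m n))
    ≡⟨ sumTo-*ˡ n (ℕtoℚ (n !)) _ ⟩
  ℕtoℚ (n !) * sumTo n (λ m → sumTo m (λ k → eλ^ lam x k * powS E k m) * powS L m n)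
    ≡⟨ cong (ℕtoℚ (n !) *_) (inversion (eλ^ lam x) n) ⟩
  ℕtoℚ (n !) * eλ^ lam x n
    ≡⟨ !-*-egf (fallλ x lam) n ⟩
  fallλ x lam n
    ∎
  where
  open ≡-Reasoning
  E = eλ-1 lam
  L = logλ lam
  open Inversion lam 1ℚ E L refl refl (eλ-1-ode lam) (logλ-ode lam)

S1λ-suc-zero : ∀ lam .{{_ : NonZero lam}} n → S1λ lam (suc n) 0 ≡ 0ℚ
S1λ-suc-zero lam n = *-zeroʳ (ℕtoℚ (suc n !))

corollary3 : (lam : ℚ) → .{{_ : NonZero lam}} → (n : ℕ) → 1 ≤ n →
    sumFrom1 n (λ m → Bellλ1 lam m * S1λ lam n m) ≡ fallλ 1ℚ lam n
corollary3 lam (suc n) _ = begin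
  sumFrom1 (suc n) (λ m → Bellλ1 lam m * S1λ lam (suc n) m)
    ≡⟨ sumTo≡sumFrom1 (suc n) _ m≡0-term ⟨
  sumTo (suc n) (λ m → Bellλ1 lam m * S1λ lam (suc n) m)
    ≡⟨ sumTo-Bellλ-*-S1λ lam 1ℚ (suc n) ⟩
  fallλ 1ℚ lam (suc n)
    ∎
  where
  open ≡-Reasoning
  m≡0-term : Bellλ1 lam 0 * S1λ lam (suc n) 0 ≡ 0ℚ
  m≡0-term = x≡0⇒y*x≡0 (Bellλ1 lam 0) (S1λ-suc-zero lam n)
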